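{- For any integer $n\ge2$, $\bar{R}(n+1;2n-1)=2n+1$.
   Context: For a positive integer $N$, $[N]=\{1,\dots,N\}$. An edge-coloring of $K_N$ with $k$ colors is a map $f:\binom{[N]}{2}\to[k]$; $\alpha_i(f)$ is the independence number of the graph on $[N]$ whose edges are the pairs of color $i$. $\bar{R}(m_1,\dots,m_k)$ is the least positive integer $N$ such that every edge-coloring $f$ of $K_N$ with $k$ colors has some $i\in[k]$ with $\alpha_i(f)\ge m_i$; $\bar{R}(m;k)$ denotes $\bar{R}(m,\dots,m)$ with $k$ arguments. -}

module Defs where

open import Data.Nat using (ℕ; _≤_; _<_)
open import Data.Fin using (Fin)
open import Data.Product using (Σ; ∃; _×_)
open import Function.Definitions using (Injective)
open import Relation.Binary.PropositionalEquality using (_≡_; _≢_)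
open import Relation.Nullary using (¬_)

-- An edge-colouring of K_N with k colours: a colour for every unordered pair
-- {x,y}, x ≠ y, represented as a symmetric function on ordered pairs
-- (values on the diagonal are irrelevant and never inspected).
record Colouring (N k : ℕ) : Set where
  field
    col : Fin N → Fin N → Fin k
    sym : ∀ x y → col x y ≡ col y x
open Colouring public

AlphaAtLeast : ∀ {N k} → Colouring N k → Fin k → ℕ → Set
AlphaAtLeast {N} f i m =
  Σ (Fin m → Fin N) λ g → Injective _≡_ _≡_ g ×
    (∀ a b → a ≢ b → col f (g a) (g b) ≢ i)

Arrows : (k : ℕ) → (Fin k → ℕ) → ℕ → Set
Arrows k m N = ∀ (f : Colouring N k) → ∃ λ i → AlphaAtLeast f i (m i)

RbarIs : (k : ℕ) → (Fin k → ℕ) → ℕ → Set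
RbarIs k m N = 1 ≤ N × Arrows k m N × (∀ M → 1 ≤ M → M < N → ¬ Arrows k m M)

RbarDiagIs : ℕ → ℕ → ℕ → Set
RbarDiagIs m k N = RbarIs k (λ _ → m) N

-- Upper bound: K_{2n+1} has (2n+1) C 2 = n(2n+1) edges, fewer than (2n-1)(n+2), so some
-- colour class has at most n+1 edges. The greedy algorithm finds an independent set of size
-- s - e in any graph with s vertices and e edges; applied after deleting a vertex of degree
-- at least 2, or (if all degrees are at most 1, so that 2e ≤ s) to the whole graph, it gives
-- an independent set of size n+1.
-- Lower bound: the classical 1-factorisation of K_{2n} on ℤ/(2n-1) ∪ {∞}, where every colour
-- class is a perfect matching and so has independence number n.
module Submission where

open import Defs hiding (sym)
open import Data.Nat using (ℕ; zero; suc; _≤_; _<_; _+_; _*_; _∸_; z≤n; s≤s; z<s; NonZero; _%_; _<?_; _≤?_)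
open import Data.Nat.Properties hiding (_≟_)
open import Data.Nat.Combinatorics using (_C_; nC1≡n; nCk+nC[k+1]≡[n+1]C[k+1])
open import Data.Nat.DivMod
  using (_mod_; m%n%n≡m%n; %-distribˡ-+; %-distribˡ-*; [m+n]%n≡m%n; [m+kn]%n≡m%n; m%n≤n; m%n<n; m<n⇒m%n≡m)
open import Data.Nat.ListAction using (sum)
open import Data.Nat.Tactic.RingSolver using (solve-∀)
open import Algebra.Properties.Semiring.Sum +-*-semiring
  using (sum-syntax; ∑-distrib-+; *-distribˡ-sum; sum-replicate-zero)
open import Algebra.Properties.CommutativeSemigroup +-commutativeSemigroup
  using (interchange; x∙yz≈y∙xz)
open import Data.Fin using (Fin; zero; suc; toℕ; inject≤; splitAt; join; _≟_)
open import Data.Fin.Properties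
  using (toℕ-injective; toℕ-fromℕ<; toℕ<n; inject≤-injective; injective⇒≤; join-splitAt)
import Data.Fin.Properties as Fin
open import Data.List using (List; []; _∷_; length; map; lookup; allFin)
open import Data.List.Properties using (length-tabulate; length-removeAt′; map-cong)
open import Data.List.Membership.Propositional using (_∈_; _─_; find)
open import Data.List.Membership.Propositional.Properties using (∈-lookup)
open import Data.List.Relation.Binary.Subset.Propositional using (_⊆_)
open import Data.List.Relation.Unary.Any using (here; there; any?)
open import Data.List.Relation.Unary.All as All using (All; []; _∷_)
open import Data.List.Relation.Unary.All.Properties using (─⁺; ¬Any⇒All¬)
open import Data.List.Relation.Unary.AllPairs using (AllPairs; []; _∷_)
open import Data.List.Relation.Unary.Unique.Propositional using (Unique)
open import Data.List.Relation.Unary.Unique.Propositional.Properties using (allFin⁺)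
open import Data.Product using (∃; _×_; _,_; proj₁; proj₂)
open import Data.Sum using (inj₁; inj₂; [_,_]′)
open import Data.Empty using (⊥-elim)
open import Function using (_∘_)
open import Function.Definitions using (Injective)
open import Relation.Binary.Definitions using (Symmetric)
open import Relation.Binary.PropositionalEquality hiding ([_])
open import Relation.Nullary using (¬_; yes; no; contradiction)
open import Relation.Nullary.Decidable using (decidable-stable)

δ : ∀ {k} → Fin k → Fin k → ℕ
δ zero    zero    = 1
δ zero    (suc _) = 0
δ (suc _) zero    = 0
δ (suc a) (suc b) = δ a b

δ-diag : ∀ {k} (a : Fin k) → δ a a ≡ 1
δ-diag zero    = refl
δ-diag (suc a) = δ-diag a

δ-≢ : ∀ {k} {a b : Fin k} → a ≢ b → δ a b ≡ 0
δ-≢ {a = zero}  {zero}  a≢b = contradiction refl a≢b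
δ-≢ {a = zero}  {suc b} _   = refl
δ-≢ {a = suc a} {zero}  _   = refl
δ-≢ {a = suc a} {suc b} a≢b = δ-≢ (a≢b ∘ cong suc)

δ-sym : ∀ {k} (a b : Fin k) → δ a b ≡ δ b a
δ-sym zero    zero    = refl
δ-sym zero    (suc b) = refl
δ-sym (suc a) zero    = refl
δ-sym (suc a) (suc b) = δ-sym a b

∑-δ : ∀ {k} (a : Fin k) → ∑[ i < k ] δ a i ≡ 1
∑-δ {suc k} zero    = cong suc (sum-replicate-zero k)
∑-δ {suc k} (suc a) = ∑-δ a

∑<*⇒∃< : ∀ {k} (g : Fin k → ℕ) q → ∑[ i < k ] g i < k * q → ∃ λ i → g i < q
∑<*⇒∃< {suc k} g q ∑< with g zero <? q
... | yes g₀<q = zero , g₀<q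
... | no  g₀≮q
  with i , gᵢ<q ← ∑<*⇒∃< (g ∘ suc) q (+-cancelˡ-< q _ _ (≤-<-trans (+-monoˡ-≤ _ (≮⇒≥ g₀≮q)) ∑<)) =
  suc i , gᵢ<q

[1+n]C2 : ∀ n → suc n C 2 ≡ n + n C 2
[1+n]C2 n = trans (sym (nCk+nC[k+1]≡[n+1]C[k+1] n 1)) (cong (_+ n C 2) (nC1≡n n))

[2n+1]C2 : ∀ n → (2 * n + 1) C 2 ≡ n * (2 * n + 1)
[2n+1]C2 zero    = refl
[2n+1]C2 (suc n) = begin
  (2 * suc n + 1) C 2                        ≡⟨ cong (_C 2) (shift n) ⟩
  suc (suc (2 * n + 1)) C 2                  ≡⟨ [1+n]C2 (suc (2 * n + 1)) ⟩
  suc (2 * n + 1) + suc (2 * n + 1) C 2      ≡⟨ cong (suc (2 * n + 1) +_) ([1+n]C2 (2 * n + 1)) ⟩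
  suc (2 * n + 1) + (2 * n + 1 + (2 * n + 1) C 2)
                                             ≡⟨ cong (λ x → suc (2 * n + 1) + (2 * n + 1 + x)) ([2n+1]C2 n) ⟩
  suc (2 * n + 1) + (2 * n + 1 + n * (2 * n + 1))
                                             ≡⟨ expand n ⟩
  suc n * (2 * suc n + 1)                    ∎
  where
  open ≡-Reasoning
  shift : ∀ n → 2 * suc n + 1 ≡ suc (suc (2 * n + 1))
  shift = solve-∀
  expand : ∀ n → suc (2 * n + 1) + (2 * n + 1 + n * (2 * n + 1)) ≡ suc n * (2 * suc n + 1)
  expand = solve-∀

module _ {A : Set} (h : A → ℕ) where

  sum-map-─ : ∀ {x} (S : List A) (x∈S : x ∈ S) → sum (map h S) ≡ h x + sum (map h (S ─ x∈S))
  sum-map-─ (y ∷ S) (here refl) = refl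
  sum-map-─ {x} (y ∷ S) (there x∈S) =
    trans (cong (h y +_) (sum-map-─ S x∈S)) (x∙yz≈y∙xz (h y) (h x) _)

  sum-map-∈ : ∀ {x} {S : List A} → x ∈ S → h x ≤ sum (map h S)
  sum-map-∈ (here refl) = m≤m+n _ _
  sum-map-∈ (there x∈S) = ≤-trans (sum-map-∈ x∈S) (m≤n+m _ _)

  sum-map-≤-length : ∀ {S : List A} → All (λ x → h x ≤ 1) S → sum (map h S) ≤ length S
  sum-map-≤-length []          = z≤n
  sum-map-≤-length (hx≤1 ∷ h≤1) = +-mono-≤ hx≤1 (sum-map-≤-length h≤1)

sum-map-+ : ∀ {A : Set} (g h : A → ℕ) (S : List A) →
            sum (map (λ x → g x + h x) S) ≡ sum (map g S) + sum (map h S)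
sum-map-+ g h []      = refl
sum-map-+ g h (x ∷ S) = trans (cong (g x + h x +_) (sum-map-+ g h S)) (interchange (g x) (h x) _ _)

Unique-─ : ∀ {A : Set} {x} {S : List A} (x∈S : x ∈ S) → Unique S → Unique (S ─ x∈S)
Unique-─ (here _)    (_ ∷ S!)    = S!
Unique-─ (there x∈S) (y∉S ∷ S!) = ─⁺ x∈S y∉S ∷ Unique-─ x∈S S!

lookup-AllPairs : ∀ {A : Set} {R : A → A → Set} → Symmetric R → ∀ {T} → AllPairs R T →
                  ∀ {a b} → a ≢ b → R (lookup T a) (lookup T b)
lookup-AllPairs R-sym (_ ∷ _)  {zero}  {zero}  a≢b = contradiction refl a≢b
lookup-AllPairs R-sym (Rx ∷ _) {zero}  {suc b} _   = All.lookup Rx (∈-lookup b)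
lookup-AllPairs R-sym (Rx ∷ _) {suc a} {zero}  _   = R-sym (All.lookup Rx (∈-lookup a))
lookup-AllPairs R-sym (_ ∷ R!) {suc a} {suc b} a≢b = lookup-AllPairs R-sym R! (a≢b ∘ cong suc)

module Counting {N k : ℕ} (f : Colouring N k) where

  -- The factor 1 ∸ δ v u makes a loop {v, v} count as a non-edge.
  adj : Fin k → Fin N → Fin N → ℕ
  adj i v u = (1 ∸ δ v u) * δ (col f v u) i

  deg : Fin k → Fin N → List (Fin N) → ℕ
  deg i v S = sum (map (adj i v) S)

  edges : Fin k → List (Fin N) → ℕ
  edges i []      = 0
  edges i (v ∷ S) = deg i v S + edges i S

  adj-sym : ∀ i u v → adj i v u ≡ adj i u v
  adj-sym i u v rewrite δ-sym v u | Colouring.sym f v u = refl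

  adj-self : ∀ i v → adj i v v ≡ 0
  adj-self i v rewrite δ-diag v = refl

  adj-col : ∀ {i v u} → u ≢ v → col f v u ≡ i → adj i v u ≡ 1
  adj-col {i} {v} u≢v refl rewrite δ-≢ (u≢v ∘ sym) | δ-diag i = refl

  ∑-adj : ∀ {v u} → u ≢ v → ∑[ i < k ] adj i v u ≡ 1
  ∑-adj {v} {u} u≢v = begin
    ∑[ i < k ] ((1 ∸ δ v u) * δ (col f v u) i)
      ≡⟨ *-distribˡ-sum (1 ∸ δ v u) (δ (col f v u)) ⟨
    (1 ∸ δ v u) * (∑[ i < k ] δ (col f v u) i)
      ≡⟨ cong₂ (λ d s → (1 ∸ d) * s) (δ-≢ (u≢v ∘ sym)) (∑-δ (col f v u)) ⟩
    1 ∎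
    where open ≡-Reasoning

  ∑-deg : ∀ {v} {S : List (Fin N)} → All (v ≢_) S → ∑[ i < k ] deg i v S ≡ length S
  ∑-deg []                 = sum-replicate-zero k
  ∑-deg {v} {u ∷ S} (v≢u ∷ v∉S) = trans (∑-distrib-+ (λ i → adj i v u) (λ i → deg i v S))
                                         (cong₂ _+_ (∑-adj (v≢u ∘ sym)) (∑-deg v∉S))

  ∑-edges : ∀ {S : List (Fin N)} → Unique S → ∑[ i < k ] edges i S ≡ length S C 2
  ∑-edges []                 = sum-replicate-zero k
  ∑-edges {v ∷ S} (v∉S ∷ S!) = begin
    ∑[ i < k ] (deg i v S + edges i S)               ≡⟨ ∑-distrib-+ (λ i → deg i v S) (λ i → edges i S) ⟩
    ∑[ i < k ] deg i v S + ∑[ i < k ] edges i S      ≡⟨ cong₂ _+_ (∑-deg v∉S) (∑-edges S!) ⟩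
    length S + length S C 2                          ≡⟨ [1+n]C2 (length S) ⟨
    suc (length S) C 2                               ∎
    where open ≡-Reasoning

  edges-─ : ∀ i {x} (S : List (Fin N)) (x∈S : x ∈ S) → edges i S ≡ deg i x S + edges i (S ─ x∈S)
  edges-─ i (y ∷ S) (here refl) rewrite adj-self i y = refl
  edges-─ i {x} (y ∷ S) (there x∈S) = begin
    deg i y S + edges i S
      ≡⟨ cong₂ _+_ (sum-map-─ (adj i y) S x∈S) (edges-─ i S x∈S) ⟩
    (adj i y x + deg i y S′) + (deg i x S + edges i S′)
      ≡⟨ cong (λ a → (a + deg i y S′) + (deg i x S + edges i S′)) (adj-sym i x y) ⟩
    (adj i x y + deg i y S′) + (deg i x S + edges i S′)
      ≡⟨ interchange (adj i x y) (deg i y S′) (deg i x S) (edges i S′) ⟩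
    (adj i x y + deg i x S) + (deg i y S′ + edges i S′)
      ∎
    where
    open ≡-Reasoning
    S′ = S ─ x∈S

  handshake : ∀ i (S : List (Fin N)) → sum (map (λ v → deg i v S) S) ≡ 2 * edges i S
  handshake i []      = refl
  handshake i (w ∷ S) = begin
    adj i w w + deg i w S + sum (map (λ v → adj i v w + deg i v S) S)
      ≡⟨ cong₂ _+_ (cong (_+ deg i w S) (adj-self i w))
                   (sum-map-+ (λ v → adj i v w) (λ v → deg i v S) S) ⟩
    deg i w S + (sum (map (λ v → adj i v w) S) + sum (map (λ v → deg i v S) S))
      ≡⟨ cong₂ (λ a b → deg i w S + (a + b))
               (cong sum (map-cong (adj-sym i w) S)) (handshake i S) ⟩
    deg i w S + (deg i w S + 2 * edges i S)
      ≡⟨ double (deg i w S) (edges i S) ⟩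
    2 * (deg i w S + edges i S)
      ∎
    where
    open ≡-Reasoning
    double : ∀ a b → a + (a + 2 * b) ≡ 2 * (a + b)
    double = solve-∀

  Independent : Fin k → Fin N → Fin N → Set
  Independent i u v = u ≢ v × col f u v ≢ i

  Independent-sym : ∀ {i} → Symmetric (Independent i)
  Independent-sym {i} {u} {v} (u≢v , ¬i) = u≢v ∘ sym , ¬i ∘ trans (Colouring.sym f u v)

  -- Keep v when it has no colour-i neighbour further along the list; otherwise drop it,
  -- which is paid for by at least one colour-i edge.
  greedy : ∀ i (S : List (Fin N)) → Unique S →
           ∃ λ T → T ⊆ S × AllPairs (Independent i) T × length S ≤ length T + edges i S
  greedy i []      _           = [] , (λ ()) , [] , z≤n
  greedy i (v ∷ S) (v∉S ∷ S!) with greedy i S S! | deg i v S in deg≡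
  ... | T , T⊆S , T-indep , bound | zero =
    v ∷ T , (λ { (here refl) → here refl ; (there x∈T) → there (T⊆S x∈T) }) ,
    All.tabulate (λ x∈T → independent (T⊆S x∈T)) ∷ T-indep , s≤s bound
    where
    independent : ∀ {x} → x ∈ S → Independent i v x
    independent x∈S = All.lookup v∉S x∈S , λ col≡i →
      1+n≰n (subst (_≤ 0) (adj-col (All.lookup v∉S x∈S ∘ sym) col≡i)
                           (subst (adj i v _ ≤_) deg≡ (sum-map-∈ (adj i v) x∈S)))
  ... | T , T⊆S , T-indep , bound | suc d =
    T , there ∘ T⊆S , T-indep ,
    ≤-trans (s≤s (≤-trans bound (+-monoʳ-≤ (length T) (m≤n+m (edges i S) d))))
            (≤-reflexive (sym (+-suc (length T) _)))

  independent⇒α≥ : ∀ {i L} (T : List (Fin N)) → AllPairs (Independent i) T → L ≤ length T →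
                   AlphaAtLeast f i L
  independent⇒α≥ {i} T T-indep L≤T = g , g-injective , λ a b → proj₂ ∘ pair
    where
    g = λ a → lookup T (inject≤ a L≤T)
    pair : ∀ {a b} → a ≢ b → Independent i (g a) (g b)
    pair a≢b = lookup-AllPairs Independent-sym T-indep (a≢b ∘ inject≤-injective L≤T L≤T _ _)
    g-injective : Injective _≡_ _≡_ g
    g-injective ga≡gb = decidable-stable (_ ≟ _) λ a≢b → proj₁ (pair a≢b) ga≡gb

  α≥-ofVertexOfHighDegree : ∀ i L {v} (S : List (Fin N)) → Unique S → (v∈S : v ∈ S) → 2 ≤ deg i v S →
                            length S + 1 ≡ L + L → edges i S ≤ L → AlphaAtLeast f i L
  α≥-ofVertexOfHighDegree i L {v} S S! v∈S 2≤deg |S|+1≡2L e≤L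
    with T , _ , T-indep , bound ← greedy i (S ─ v∈S) (Unique-─ v∈S S!) =
    independent⇒α≥ T T-indep (+-cancelʳ-≤ L L (length T) (begin
      L + L                                 ≡⟨ |S|+1≡2L ⟨
      length S + 1                          ≡⟨ cong (_+ 1) (length-removeAt′ S _) ⟩
      suc (length S′) + 1                   ≡⟨ +-comm _ 1 ⟩
      2 + length S′                         ≤⟨ +-monoʳ-≤ 2 bound ⟩
      2 + (length T + edges i S′)           ≡⟨ x∙yz≈y∙xz 2 (length T) _ ⟩
      length T + (2 + edges i S′)           ≤⟨ +-monoʳ-≤ (length T) (+-monoˡ-≤ _ 2≤deg) ⟩
      length T + (deg i v S + edges i S′)   ≡⟨ cong (length T +_) (edges-─ i S v∈S) ⟨
      length T + edges i S                  ≤⟨ +-monoʳ-≤ (length T) e≤L ⟩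
      length T + L                          ∎))
    where
    open ≤-Reasoning
    S′ = S ─ v∈S

  α≥-ofMaxDegree≤1 : ∀ i L (S : List (Fin N)) → Unique S → All (λ v → deg i v S ≤ 1) S →
                     length S + 1 ≡ L + L → AlphaAtLeast f i L
  α≥-ofMaxDegree≤1 i L S S! deg≤1 |S|+1≡2L with T , _ , T-indep , bound ← greedy i S S! =
    independent⇒α≥ T T-indep (+-cancelʳ-≤ L L (length T) (begin
      L + L                ≡⟨ |S|+1≡2L ⟨
      length S + 1         ≤⟨ +-monoˡ-≤ 1 bound ⟩
      length T + e + 1     ≡⟨ +-comm _ 1 ⟩
      suc (length T + e)   ≡⟨ +-suc (length T) e ⟨
      length T + suc e     ≤⟨ +-monoʳ-≤ (length T) e<L ⟩
      length T + L         ∎))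
    where
    open ≤-Reasoning
    e = edges i S
    e<L : e < L
    e<L = *-cancelˡ-< 2 e L (begin-strict
      2 * e         ≡⟨ handshake i S ⟨
      sum (map (λ v → deg i v S) S) ≤⟨ sum-map-≤-length _ deg≤1 ⟩
      length S      <⟨ m<m+n (length S) z<s ⟩
      length S + 1  ≡⟨ |S|+1≡2L ⟩
      L + L         ≡⟨ cong (L +_) (+-identityʳ L) ⟨
      2 * L         ∎)

  α≥-ofFewEdges : ∀ i L (S : List (Fin N)) → Unique S → length S + 1 ≡ L + L → edges i S ≤ L →
                  AlphaAtLeast f i L
  α≥-ofFewEdges i L S S! |S|+1≡2L e≤L with any? (λ v → 2 ≤? deg i v S) S
  ... | yes high with v , v∈S , 2≤deg ← find high =
    α≥-ofVertexOfHighDegree i L S S! v∈S 2≤deg |S|+1≡2L e≤L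
  ... | no ¬high =
    α≥-ofMaxDegree≤1 i L S S! (All.map (m<1+n⇒m≤n ∘ ≰⇒>) (¬Any⇒All¬ S ¬high)) |S|+1≡2L

arrows-ofEdgeCount : ∀ k L N → N + 1 ≡ L + L → N C 2 < k * (L + 1) → Arrows k (λ _ → L) N
arrows-ofEdgeCount k L N N+1≡2L count f =
  proj₁ sparse , α≥-ofFewEdges (proj₁ sparse) L (allFin N) S! (trans (cong (_+ 1) |S|≡N) N+1≡2L)
                   (m<1+n⇒m≤n (subst (edges (proj₁ sparse) (allFin N) <_) (+-comm L 1) (proj₂ sparse)))
  where
  open Counting f
  S! = allFin⁺ N
  |S|≡N = length-tabulate (λ x → x)
  sparse : ∃ λ i → edges i (allFin N) < L + 1
  sparse = ∑<*⇒∃< (λ i → edges i (allFin N)) (L + 1)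
             (subst (_< k * (L + 1)) (sym (trans (∑-edges S!) (cong (_C 2) |S|≡N))) count)

restrict : ∀ {M N k} → M ≤ N → Colouring N k → Colouring M k
restrict M≤N f = record
  { col = λ u v → col f (inject≤ u M≤N) (inject≤ v M≤N)
  ; sym = λ u v → Colouring.sym f (inject≤ u M≤N) (inject≤ v M≤N)
  }

Arrows-mono : ∀ {k m M N} → M ≤ N → Arrows k m M → Arrows k m N
Arrows-mono M≤N arrows f with i , g , g-injective , g-indep ← arrows (restrict M≤N f) =
  i , (λ a → inject≤ (g a) M≤N) , g-injective ∘ inject≤-injective M≤N M≤N _ _ , g-indep

-- An independent set I and its image p(I) under the matching are disjoint.
perfectMatching⇒α≤ : ∀ {N k L c} (f : Colouring N k) (p : Fin N → Fin N) →
                     (∀ v → p v ≢ v) → (∀ v → col f v (p v) ≡ c) → (∀ v → p (p v) ≡ v) →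
                     AlphaAtLeast f c L → L + L ≤ N
perfectMatching⇒α≤ {L = L} f p p≢ col-p p-involutive (g , g-injective , g-indep) =
  injective⇒≤ h-injective
  where
  p-injective : Injective _≡_ _≡_ p
  p-injective {u} {v} pu≡pv = trans (sym (p-involutive u)) (trans (cong p pu≡pv) (p-involutive v))
  g≢pg : ∀ a b → g a ≢ p (g b)
  g≢pg a b ga≡pgb with a ≟ b
  ... | yes refl = p≢ (g a) (sym ga≡pgb)
  ... | no a≢b   = g-indep a b a≢b
    (trans (cong (λ x → col f x (g b)) ga≡pgb) (trans (Colouring.sym f _ _) (col-p (g b))))
  [g,pg]-injective : Injective _≡_ _≡_ [ g , p ∘ g ]′
  [g,pg]-injective {inj₁ a} {inj₁ b} e = cong inj₁ (g-injective e)
  [g,pg]-injective {inj₂ a} {inj₂ b} e = cong inj₂ (g-injective (p-injective e))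
  [g,pg]-injective {inj₁ a} {inj₂ b} e = ⊥-elim (g≢pg a b e)
  [g,pg]-injective {inj₂ a} {inj₁ b} e = ⊥-elim (g≢pg b a (sym e))
  h-injective : Injective _≡_ _≡_ ([ g , p ∘ g ]′ ∘ splitAt L)
  h-injective {x} {y} e = begin
    x                       ≡⟨ join-splitAt L L x ⟨
    join L L (splitAt L x)  ≡⟨ cong (join L L) ([g,pg]-injective {splitAt L x} {splitAt L y} e) ⟩
    join L L (splitAt L y)  ≡⟨ join-splitAt L L y ⟩
    y                       ∎
    where open ≡-Reasoning

-- Vertices are Fin (suc m), with zero playing the role of ∞ and suc a that of a ∈ ℤ/m. An edge
-- {a, b} gets the colour (a + b)/2 and {a, ∞} the colour a; 2 is invertible mod m with inverse n.
module OneFactorisation (m : ℕ) {{_ : NonZero m}} (n : ℕ) (n+n≡1+m : n + n ≡ suc m) where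

  infix 4 _≋_
  _≋_ : ℕ → ℕ → Set
  x ≋ y = x % m ≡ y % m

  %-≋ : ∀ x → x % m ≋ x
  %-≋ x = m%n%n≡m%n x m

  +-cong-≋ : ∀ {x x′ y y′} → x ≋ x′ → y ≋ y′ → x + y ≋ x′ + y′
  +-cong-≋ {x} {x′} {y} {y′} x≋x′ y≋y′ = begin
    (x + y) % m                 ≡⟨ %-distribˡ-+ x y m ⟩
    (x % m + y % m) % m         ≡⟨ cong₂ (λ a b → (a + b) % m) x≋x′ y≋y′ ⟩
    (x′ % m + y′ % m) % m       ≡⟨ %-distribˡ-+ x′ y′ m ⟨
    (x′ + y′) % m               ∎
    where open ≡-Reasoning

  +-congˡ-≋ : ∀ x {y y′} → y ≋ y′ → x + y ≋ x + y′
  +-congˡ-≋ x = +-cong-≋ {x} refl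

  *-congʳ-≋ : ∀ {x x′} z → x ≋ x′ → x * z ≋ x′ * z
  *-congʳ-≋ {x} {x′} z x≋x′ = begin
    (x * z) % m                 ≡⟨ %-distribˡ-* x z m ⟩
    (x % m * (z % m)) % m       ≡⟨ cong (λ a → (a * (z % m)) % m) x≋x′ ⟩
    (x′ % m * (z % m)) % m      ≡⟨ %-distribˡ-* x′ z m ⟨
    (x′ * z) % m                ∎
    where open ≡-Reasoning

  +-cancelˡ-≋ : ∀ x {y z} → x + y ≋ x + z → y ≋ z
  +-cancelˡ-≋ x {y} {z} x+y≋x+z =
    trans (add-complement y) (trans (+-congˡ-≋ (m ∸ x % m) x+y≋x+z) (sym (add-complement z)))
    where
    x≤m = m%n≤n x m
    add-complement : ∀ y → y ≋ (m ∸ x % m) + (x + y)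
    add-complement y = begin
      y % m                           ≡⟨ [m+n]%n≡m%n y m ⟨
      (y + m) % m                     ≡⟨ cong (_% m) (trans (+-comm y m) (cong (_+ y) (sym (m∸n+n≡m x≤m)))) ⟩
      ((m ∸ x % m) + x % m + y) % m   ≡⟨ cong (_% m) (+-assoc (m ∸ x % m) _ y) ⟩
      ((m ∸ x % m) + (x % m + y)) % m ≡⟨ +-congˡ-≋ (m ∸ x % m) (+-cong-≋ (%-≋ x) refl) ⟩
      ((m ∸ x % m) + (x + y)) % m     ∎
      where open ≡-Reasoning

  double*n≋ : ∀ c → (c + c) * n ≋ c
  double*n≋ c = begin
    ((c + c) * n) % m     ≡⟨ cong (_% m) (trans (*-distribʳ-+ n c c) (sym (*-distribˡ-+ c n n))) ⟩
    (c * (n + n)) % m     ≡⟨ cong (λ a → (c * a) % m) n+n≡1+m ⟩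
    (c * suc m) % m       ≡⟨ cong (_% m) (*-suc c m) ⟩
    (c + c * m) % m       ≡⟨ [m+kn]%n≡m%n c c m ⟩
    c % m                 ∎
    where open ≡-Reasoning

  [_] : ℕ → Fin m
  [ x ] = x mod m

  []-≋ : ∀ x → toℕ [ x ] ≋ x
  []-≋ x = trans (cong (_% m) (toℕ-fromℕ< (m%n<n x m))) (%-≋ x)

  ≋⇒≡ : ∀ {a b : Fin m} → toℕ a ≋ toℕ b → a ≡ b
  ≋⇒≡ {a} {b} a≋b =
    toℕ-injective (trans (sym (m<n⇒m%n≡m (toℕ<n a))) (trans a≋b (m<n⇒m%n≡m (toℕ<n b))))

  mid : Fin m → Fin m → Fin m
  mid a b = [ (toℕ a + toℕ b) * n ]

  reflect : Fin m → Fin m → Fin m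
  reflect c a = [ toℕ c + toℕ c + (m ∸ toℕ a) ]

  mid≡ : ∀ a b c → toℕ a + toℕ b ≋ toℕ c + toℕ c → mid a b ≡ c
  mid≡ a b c a+b≋2c = ≋⇒≡ (trans ([]-≋ _) (trans (*-congʳ-≋ n a+b≋2c) (double*n≋ (toℕ c))))

  +reflect≋ : ∀ c a → toℕ a + toℕ (reflect c a) ≋ toℕ c + toℕ c
  +reflect≋ c a =
    trans (+-congˡ-≋ (toℕ a) ([]-≋ _)) (trans (cong (_% m) a+[2c+m-a]≡2c+m) ([m+n]%n≡m%n _ m))
    where
    a+[2c+m-a]≡2c+m : toℕ a + (toℕ c + toℕ c + (m ∸ toℕ a)) ≡ toℕ c + toℕ c + m
    a+[2c+m-a]≡2c+m = trans (x∙yz≈y∙xz (toℕ a) (toℕ c + toℕ c) (m ∸ toℕ a))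
                            (cong (toℕ c + toℕ c +_) (m+[n∸m]≡n (<⇒≤ (toℕ<n a))))

  reflect-involutive : ∀ c a → reflect c (reflect c a) ≡ a
  reflect-involutive c a = ≋⇒≡ (+-cancelˡ-≋ (toℕ b)
    (trans (+reflect≋ c b) (trans (sym (+reflect≋ c a)) (cong (_% m) (+-comm (toℕ a) (toℕ b))))))
    where b = reflect c a

  reflect≡self⇒≡ : ∀ {c a} → reflect c a ≡ a → a ≡ c
  reflect≡self⇒≡ {c} {a} r≡a =
    trans (sym (mid≡ a a a refl)) (mid≡ a a c (subst (λ r → toℕ a + toℕ r ≋ _) r≡a (+reflect≋ c a)))

  reflect≡centre⇒≡ : ∀ {c a} → reflect c a ≡ c → a ≡ c
  reflect≡centre⇒≡ {c} {a} r≡c = ≋⇒≡ (+-cancelˡ-≋ (toℕ c)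
    (trans (cong (_% m) (+-comm (toℕ c) (toℕ a)))
           (subst (λ r → toℕ a + toℕ r ≋ _) r≡c (+reflect≋ c a))))

  colour : Fin (suc m) → Fin (suc m) → Fin m
  colour zero    zero    = [ 0 ]
  colour zero    (suc b) = b
  colour (suc a) zero    = a
  colour (suc a) (suc b) = mid a b

  colour-sym : ∀ u v → colour u v ≡ colour v u
  colour-sym zero    zero    = refl
  colour-sym zero    (suc b) = refl
  colour-sym (suc a) zero    = refl
  colour-sym (suc a) (suc b) = cong (λ x → [ x * n ]) (+-comm (toℕ a) (toℕ b))

  K : Colouring (suc m) m
  K = record { col = colour ; sym = colour-sym }

  partner : Fin m → Fin (suc m) → Fin (suc m)
  partner c zero    = suc c
  partner c (suc a) with a ≟ c
  ... | yes _ = zero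
  ... | no  _ = suc (reflect c a)

  colour-partner : ∀ c v → colour v (partner c v) ≡ c
  colour-partner c zero    = refl
  colour-partner c (suc a) with a ≟ c
  ... | yes a≡c = a≡c
  ... | no  _   = mid≡ a (reflect c a) c (+reflect≋ c a)

  partner-≢ : ∀ c v → partner c v ≢ v
  partner-≢ c zero    ()
  partner-≢ c (suc a) with a ≟ c
  ... | yes _   = λ ()
  ... | no  a≢c = a≢c ∘ reflect≡self⇒≡ ∘ Fin.suc-injective

  partner-involutive : ∀ c v → partner c (partner c v) ≡ v
  partner-involutive c zero with c ≟ c
  ... | yes _   = refl
  ... | no  c≢c = contradiction refl c≢c
  partner-involutive c (suc a) with a ≟ c
  ... | yes a≡c = cong suc (sym a≡c)
  ... | no  a≢c with reflect c a ≟ c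
  ...   | yes r≡c = contradiction (reflect≡centre⇒≡ r≡c) a≢c
  ...   | no  _   = cong suc (reflect-involutive c a)

  ¬arrows : ¬ Arrows m (λ _ → n + 1) (suc m)
  ¬arrows arrows with c , α≥ ← arrows K =
    <⇒≱ (subst (_< (n + 1) + (n + 1)) n+n≡1+m (+-mono-< (m<m+n n z<s) (m<m+n n z<s)))
        (perfectMatching⇒α≤ K (partner c) (partner-≢ c) (colour-partner c) (partner-involutive c) α≥)

n+n≡1+[2n∸1] : ∀ n → 1 ≤ n → n + n ≡ suc (2 * n ∸ 1)
n+n≡1+[2n∸1] (suc n) _ = cong (λ x → suc (n + x)) (sym (+-identityʳ (suc n)))

edgeCount< : ∀ t → (2 * (2 + t) + 1) C 2 < (2 * (2 + t) ∸ 1) * (2 + t + 1 + 1)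
edgeCount< t = begin-strict
  (2 * n + 1) C 2                    ≡⟨ [2n+1]C2 n ⟩
  n * (2 * n + 1)                    <⟨ m<m+n _ z<s ⟩
  n * (2 * n + 1) + suc (2 * t + 1)  ≡⟨ expand t ⟩
  (3 + 2 * t) * (n + 1 + 1)          ≡⟨ cong (_* (n + 1 + 1)) 2n∸1≡3+2t ⟨
  (2 * n ∸ 1) * (n + 1 + 1)          ∎
  where
  open ≤-Reasoning
  n = 2 + t
  2n∸1≡3+2t : 2 * n ∸ 1 ≡ 3 + 2 * t
  2n∸1≡3+2t = cong suc (trans (+-suc t _) (cong suc (+-suc t _)))
  expand : ∀ t → (2 + t) * (2 * (2 + t) + 1) + suc (2 * t + 1) ≡ (3 + 2 * t) * (2 + t + 1 + 1)
  expand = solve-∀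

corollary5p1 : ∀ (n : ℕ) → 2 ≤ n → RbarDiagIs (n + 1) (2 * n ∸ 1) (2 * n + 1)
corollary5p1 (suc zero) (s≤s ())
corollary5p1 n@(suc (suc t)) _ = s≤s z≤n , upper , lower
  where
  2n≡1+[2n∸1] : 2 * n ≡ suc (2 * n ∸ 1)
  2n≡1+[2n∸1] = trans (cong (n +_) (+-identityʳ n)) (n+n≡1+[2n∸1] n (s≤s z≤n))
  upper : Arrows (2 * n ∸ 1) (λ _ → n + 1) (2 * n + 1)
  upper = arrows-ofEdgeCount (2 * n ∸ 1) (n + 1) (2 * n + 1) (2n+2≡2[n+1] n) (edgeCount< t)
    where
    2n+2≡2[n+1] : ∀ n → 2 * n + 1 + 1 ≡ n + 1 + (n + 1)
    2n+2≡2[n+1] = solve-∀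
  lower : ∀ M → 1 ≤ M → M < 2 * n + 1 → ¬ Arrows (2 * n ∸ 1) (λ _ → n + 1) M
  lower M _ M<N = OneFactorisation.¬arrows (2 * n ∸ 1) n (n+n≡1+[2n∸1] n (s≤s z≤n)) ∘ Arrows-mono M≤2n
    where
    M≤2n : M ≤ suc (2 * n ∸ 1)
    M≤2n = subst (M ≤_) 2n≡1+[2n∸1] (m<1+n⇒m≤n (subst (M <_) (+-comm (2 * n) 1) M<N))
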